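{- Let $G$ be a graph with $G\notin\mathrm{BP2}$. Then the complement $\bar G$ satisfies: (1) for every vertex $v$ of $\bar G$, the set $N_{\bar G}(v)$ of neighbours of $v$ in $\bar G$ induces a connected subgraph of $\bar G$ having at least two vertices; (2) for every vertex $v$ of $\bar G$, every other vertex of $\bar G$ is at distance at most two from $v$ in $\bar G$; (3) any two nonadjacent vertices of $\bar G$ have a common neighbour in $\bar G$.
   Context: All graphs are finite, simple and undirected. A biclique of a graph $G$ is a subgraph of $G$ isomorphic to $K_1$ or to $K_{m,n}$ for some $m,n\ge1$. BP2 is the set of graphs whose vertex set can be covered by at most two bicliques. $\bar G$ is the complement of $G$; $N_H(v)$ is the set of vertices adjacent to $v$ in $H$ (not including $v$). -}

module Defs where

open import Data.Nat using (ℕ)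
open import Data.Fin using (Fin)
open import Data.Bool using (Bool; true; false; not; _∧_)
open import Data.List using (List; length; _∷_; [])
open import Data.List.Membership.Propositional using () renaming (_∈_ to _∈ₗ_)
open import Data.Nat using (_≤_)
open import Data.Product using (Σ; ∃; ∃-syntax; _×_; _,_)
open import Data.Sum using (_⊎_)
open import Relation.Binary.PropositionalEquality using (_≡_; _≢_)
open import Relation.Binary.Construct.Closure.ReflexiveTransitive using (Star)
open import Relation.Nullary using (¬_)

record Graph (n : ℕ) : Set where
  field
    adj   : Fin n → Fin n → Bool
    adj-sym : ∀ u v → adj u v ≡ adj v u
    adj-irrefl : ∀ v → adj v v ≡ false
open Graph public

_~[_]_ : ∀ {n} → Fin n → Graph n → Fin n → Set
u ~[ G ] v = adj G u v ≡ true

complement : ∀ {n} → Graph n → Graph n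
complement {n} G = record { adj = cadj ; adj-sym = csym ; adj-irrefl = cirr }
  where
  open import Data.Fin using (_≟_)
  open import Relation.Nullary using (yes; no)
  open import Relation.Binary.PropositionalEquality using (refl; cong; sym)
  cadj : Fin n → Fin n → Bool
  cadj u v with u ≟ v
  ... | yes _ = false
  ... | no  _ = not (adj G u v)
  csym : ∀ u v → cadj u v ≡ cadj v u
  csym u v with u ≟ v | v ≟ u
  ... | yes _ | yes _ = refl
  ... | yes p | no q = Data.Empty.⊥-elim (q (sym p))
    where import Data.Empty
  ... | no p | yes q = Data.Empty.⊥-elim (p (sym q))
    where import Data.Empty
  ... | no _ | no _ = cong not (adj-sym G u v)
  cirr : ∀ v → cadj v v ≡ false
  cirr v with v ≟ v
  ... | yes _ = refl
  ... | no p = Data.Empty.⊥-elim (p refl)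
    where import Data.Empty

-- A biclique of G: a subgraph isomorphic to K₁ (a single vertex), or to
-- K_{m,m'} with m, m' ≥ 1, given by two disjoint nonempty vertex sets A, B
-- with every vertex of A adjacent in G to every vertex of B.
data Biclique {n : ℕ} (G : Graph n) : Set where
  k1  : Fin n → Biclique G
  kmn : (A B : Fin n → Bool)
      → (∀ v → A v ≡ true → B v ≡ false)
      → (∃[ a ] A a ≡ true)
      → (∃[ b ] B b ≡ true)
      → (∀ a b → A a ≡ true → B b ≡ true → a ~[ G ] b)
      → Biclique G

InBiclique : ∀ {n} {G : Graph n} → Fin n → Biclique G → Set
InBiclique u (k1 v) = u ≡ v
InBiclique u (kmn A B _ _ _ _) = A u ≡ true ⊎ B u ≡ true

BP2 : ∀ {n} → Graph n → Set
BP2 {n} G = Σ (List (Biclique G)) λ bs →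
  (length bs ≤ 2) × (∀ (v : Fin n) → ∃[ b ] (b ∈ₗ bs × InBiclique v b))

N : ∀ {n} → Graph n → Fin n → Fin n → Set
N H v u = v ~[ H ] u

InducedEdge : ∀ {n} → Graph n → (Fin n → Set) → Fin n → Fin n → Set
InducedEdge H S x y = S x × S y × x ~[ H ] y

NeighbourhoodConnected≥2 : ∀ {n} → Graph n → Fin n → Set
NeighbourhoodConnected≥2 H v =
  (∃[ x ] ∃[ y ] (x ≢ y × N H v x × N H v y))
  × (∀ x y → N H v x → N H v y → Star (InducedEdge H (N H v)) x y)

Dist≤2 : ∀ {n} → Graph n → Fin n → Fin n → Set
Dist≤2 H v u = u ≡ v ⊎ v ~[ H ] u ⊎ (∃[ w ] (v ~[ H ] w × w ~[ H ] u))

-- Let H be the complement of G.  Every vertex z other than v is either a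
-- G-neighbour of v or an H-neighbour of v, so the closed G-neighbourhood of v
-- (which is a star, hence a single biclique of G) covers everything outside
-- N_H(v).  Consequently, if G ∉ BP2 then N_H(v) is never covered by a single
-- biclique of G; this "covering lemma" drives the whole proof:
--   * N_H(v) has two distinct vertices, since ∅ and {x} are covered by K₁;
--   * N_H(v) induces a connected subgraph of H: if the H-component C of x in
--     N_H(v) missed some y, then (C , N_H(v) ∖ C) would be a biclique of G,
--     because distinct vertices on both sides of the cut are non-adjacent in H;
--   * any u, w have a common H-neighbour: otherwise N_H(u) lies in the closed
--     G-neighbourhood of w, covered by one biclique; distance ≤ 2 follows.

module Submission where

open import Defs
open import Data.Nat using (ℕ; s≤s; z≤n)
open import Data.Bool using (Bool; true; false; not)
import Data.Bool as Bool
open import Data.Bool.Properties using (¬-not)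
open import Data.Fin using (Fin; _≟_)
open import Data.Fin.Properties using (any?)
open import Data.Fin.Subset using (Subset; _∈_; _∉_; _⊃_; _∪_; ⁅_⁆)
open import Data.Fin.Subset.Properties
  using (_∈?_; x∈⁅x⁆; x∈⁅y⁆⇒x≡y; p⊆p∪q; q⊆p∪q; x∈p∪q⁻)
open import Data.Fin.Subset.Induction using (⊃-wellFounded; Acc; acc)
open import Data.List using (_∷_; [])
open import Data.List.Relation.Unary.Any using (here; there)
open import Data.List.Membership.Propositional using () renaming (_∈_ to _∈ₗ_)
open import Data.Product using (_×_; ∃-syntax; Σ; _,_; proj₁; proj₂)
open import Data.Sum using (_⊎_; inj₁; inj₂; [_,_]′)
open import Data.Empty using (⊥-elim)
open import Function using (id)
open import Relation.Binary.PropositionalEquality using (_≡_; _≢_; refl; sym; trans; subst)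
open import Relation.Binary.Construct.Closure.ReflexiveTransitive using (Star; ε; _◅◅_; _◅_)
open import Relation.Nullary using (¬_; Dec; yes; no; does; ¬?; _×-dec_)
open import Relation.Nullary.Decidable using (dec-true; dec-false; decidable-stable)

witness : ∀ {A : Set} (a? : Dec A) → does a? ≡ true → A
witness (yes a) _ = a
witness (no _) ()

-- It is obtained by adding escaping edge targets one at a time,
-- which terminates because ⊃ is well founded on subsets of Fin n.
module Reachability {n : ℕ} {_⟶_ : Fin n → Fin n → Set}
  (_⟶?_ : ∀ a b → Dec (a ⟶ b)) where

  record ClosedReach (x : Fin n) : Set where
    field
      members   : Subset n
      root      : x ∈ members
      reachable : ∀ {z} → z ∈ members → Star _⟶_ x z
      closed    : ∀ {a b} → a ∈ members → a ⟶ b → b ∈ members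

  closedReach : ∀ x → ClosedReach x
  closedReach x = grow ⁅ x ⁆ (⊃-wellFounded ⁅ x ⁆) (x∈⁅x⁆ x) fromRoot
    where
    fromRoot : ∀ {z} → z ∈ ⁅ x ⁆ → Star _⟶_ x z
    fromRoot z∈⁅x⁆ = subst (Star _⟶_ x) (sym (x∈⁅y⁆⇒x≡y x z∈⁅x⁆)) ε

    grow : ∀ R → Acc _⊃_ R → x ∈ R → (∀ {z} → z ∈ R → Star _⟶_ x z) → ClosedReach x
    grow R (acc smaller) x∈R reach
      with any? (λ a → any? (λ b → (a ∈? R) ×-dec (a ⟶? b) ×-dec ¬? (b ∈? R)))
    ... | no noExit = record
      { members = R ; root = x∈R ; reachable = reach ; closed = closedR }
      where
      closedR : ∀ {a b} → a ∈ R → a ⟶ b → b ∈ R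
      closedR {a} {b} a∈R a⟶b =
        decidable-stable (b ∈? R) (λ b∉R → noExit (a , b , a∈R , a⟶b , b∉R))
    ... | yes (a , b , a∈R , a⟶b , b∉R) =
      grow (R ∪ ⁅ b ⁆) (smaller R⊂R′) (p⊆p∪q ⁅ b ⁆ x∈R) reach′
      where
      R⊂R′ : (R ∪ ⁅ b ⁆) ⊃ R
      R⊂R′ = p⊆p∪q ⁅ b ⁆ , b , q⊆p∪q R ⁅ b ⁆ (x∈⁅x⁆ b) , b∉R
      reach′ : ∀ {z} → z ∈ R ∪ ⁅ b ⁆ → Star _⟶_ x z
      reach′ {z} z∈R′ with x∈p∪q⁻ R ⁅ b ⁆ z∈R′
      ... | inj₁ z∈R = reach z∈R
      ... | inj₂ z∈⁅b⁆ rewrite x∈⁅y⁆⇒x≡y b z∈⁅b⁆ = reach a∈R ◅◅ (a⟶b ◅ ε)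

module _ {n : ℕ} where

  adjacent? : (H : Graph n) → ∀ u v → Dec (u ~[ H ] v)
  adjacent? H u v = adj H u v Bool.≟ true

  ~-sym : (H : Graph n) → ∀ {u v} → u ~[ H ] v → v ~[ H ] u
  ~-sym H {u} {v} u~v = trans (adj-sym H v u) u~v

  inducedEdge? : (H : Graph n) {S : Fin n → Set} → (∀ z → Dec (S z))
    → ∀ a b → Dec (InducedEdge H S a b)
  inducedEdge? H S? a b = S? a ×-dec S? b ×-dec adjacent? H a b

  ClosedNbhd : Graph n → Fin n → Fin n → Set
  ClosedNbhd G v z = z ≡ v ⊎ v ~[ G ] z

  Covers : {G : Graph n} → Biclique G → (Fin n → Set) → Set
  Covers b S = ∀ z → S z → InBiclique z b

module Complement {n : ℕ} (G : Graph n) where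

  H : Graph n
  H = complement G

  complement-adj : ∀ {u v} → u ≢ v → adj H u v ≡ not (adj G u v)
  complement-adj {u} {v} u≢v with u ≟ v
  ... | yes u≡v = ⊥-elim (u≢v u≡v)
  ... | no _ = refl

  adjacent-in-H : ∀ {u v} → u ≢ v → ¬ u ~[ G ] v → u ~[ H ] v
  adjacent-in-H u≢v ¬u~v rewrite complement-adj u≢v | ¬-not ¬u~v = refl

  adjacent-in-G : ∀ {u v} → u ≢ v → ¬ u ~[ H ] v → u ~[ G ] v
  adjacent-in-G {u} {v} u≢v ¬u~v =
    decidable-stable (adjacent? G u v) (λ ¬u~v′ → ¬u~v (adjacent-in-H u≢v ¬u~v′))

  closedNbhd-or-coNbhd : ∀ v z → ClosedNbhd G v z ⊎ N H v z
  closedNbhd-or-coNbhd v z with z ≟ v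
  ... | yes z≡v = inj₁ (inj₁ z≡v)
  ... | no z≢v with adjacent? G v z
  ...   | yes v~z = inj₁ (inj₂ v~z)
  ...   | no ¬v~z = inj₂ (adjacent-in-H (λ v≡z → z≢v (sym v≡z)) ¬v~z)

module Bicliques {n : ℕ} (G : Graph n) where

  fromSides : {P Q : Fin n → Set} (P? : ∀ z → Dec (P z)) (Q? : ∀ z → Dec (Q z))
    → (∀ {z} → P z → ¬ Q z) → ∃[ a ] P a → ∃[ b ] Q b
    → (∀ {a b} → P a → Q b → a ~[ G ] b)
    → Σ (Biclique G) λ bc → Covers bc (λ z → P z ⊎ Q z)
  fromSides {P} {Q} P? Q? disjoint (a , Pa) (b , Qb) complete =
    kmn A B disj (a , dec-true (P? a) Pa) (b , dec-true (Q? b) Qb) join , cover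
    where
    A B : Fin n → Bool
    A z = does (P? z)
    B z = does (Q? z)
    disj : ∀ z → A z ≡ true → B z ≡ false
    disj z Az = dec-false (Q? z) (disjoint (witness (P? z) Az))
    join : ∀ x y → A x ≡ true → B y ≡ true → x ~[ G ] y
    join x y Ax By = complete (witness (P? x) Ax) (witness (Q? y) By)
    cover : ∀ z → P z ⊎ Q z → A z ≡ true ⊎ B z ≡ true
    cover z (inj₁ Pz) = inj₁ (dec-true (P? z) Pz)
    cover z (inj₂ Qz) = inj₂ (dec-true (Q? z) Qz)

  -- A closed neighbourhood is covered by one biclique: the star at v,
  -- or K₁ when v is isolated.
  closedStar : ∀ v → Σ (Biclique G) λ bc → Covers bc (ClosedNbhd G v)
  closedStar v with any? (adjacent? G v)
  ... | yes G-nbr = fromSides (_≟ v) (adjacent? G v) disjoint (v , refl) G-nbr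
                      (λ { refl v~b → v~b })
    where
    disjoint : ∀ {z} → z ≡ v → ¬ v ~[ G ] z
    disjoint refl v~v with trans (sym (adj-irrefl G v)) v~v
    ... | ()
  ... | no isolated = k1 v , λ { z (inj₁ z≡v) → z≡v
                               ; z (inj₂ v~z) → ⊥-elim (isolated (z , v~z)) }

  twoCover⇒BP2 : (b₁ b₂ : Biclique G)
    → (∀ z → InBiclique z b₁ ⊎ InBiclique z b₂) → BP2 G
  twoCover⇒BP2 b₁ b₂ cover = (b₁ ∷ b₂ ∷ []) , s≤s (s≤s z≤n) , pick
    where
    pick : ∀ z → ∃[ b ] (b ∈ₗ (b₁ ∷ b₂ ∷ []) × InBiclique z b)
    pick z with cover z
    ... | inj₁ z∈b₁ = b₁ , here refl , z∈b₁
    ... | inj₂ z∈b₂ = b₂ , there (here refl) , z∈b₂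

  open Complement G

  -- The covering lemma: a biclique of G covering N_H(v) yields BP2,
  -- since the star at v covers all remaining vertices.
  coNbhdCover⇒BP2 : ∀ v (bc : Biclique G) → Covers bc (N H v) → BP2 G
  coNbhdCover⇒BP2 v bc covers = twoCover⇒BP2 star bc cover
    where
    star : Biclique G
    star = proj₁ (closedStar v)
    cover : ∀ z → InBiclique z star ⊎ InBiclique z bc
    cover z with closedNbhd-or-coNbhd v z
    ... | inj₁ closed = inj₁ (proj₂ (closedStar v) z closed)
    ... | inj₂ co-nbr = inj₂ (covers z co-nbr)

module Density {n : ℕ} (G : Graph n) (¬bp2 : ¬ BP2 G) where

  open Complement G
  open Bicliques G

  twoCoNeighbours : ∀ v → ∃[ x ] ∃[ y ] (x ≢ y × N H v x × N H v y)
  twoCoNeighbours v with any? (adjacent? H v)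
  ... | no empty =
    ⊥-elim (¬bp2 (coNbhdCover⇒BP2 v (k1 v) λ z v~z → ⊥-elim (empty (z , v~z))))
  ... | yes (x , Nx) with any? (λ y → ¬? (x ≟ y) ×-dec adjacent? H v y)
  ...   | yes (y , x≢y , Ny) = x , y , x≢y , Nx , Ny
  ...   | no single = ⊥-elim (¬bp2 (coNbhdCover⇒BP2 v (k1 x) onlyX))
    where
    onlyX : Covers {G = G} (k1 x) (N H v)
    onlyX z Nz = sym (decidable-stable (x ≟ z) (λ x≢z → single (z , x≢z , Nz)))

  -- The H-component of a vertex x of N_H(v) inside N_H(v) is everything:
  -- otherwise the cut it defines is a biclique of G covering N_H(v).
  module CoNbhdComponent (v x : Fin n) (Nx : N H v x) where
    open Reachability (inducedEdge? H (adjacent? H v))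
    open ClosedReach (closedReach x)

    Inside Outside : Fin n → Set
    Inside z = z ∈ members × N H v z
    Outside z = z ∉ members × N H v z

    -- Vertices on opposite sides are distinct and not H-adjacent, so G-adjacent.
    across : ∀ {a b} → Inside a → Outside b → a ~[ G ] b
    across {a} {b} (a∈C , Na) (b∉C , Nb) with a ≟ b
    ... | yes refl = ⊥-elim (b∉C a∈C)
    ... | no a≢b = adjacent-in-G a≢b (λ a~b → b∉C (closed a∈C (Na , Nb , a~b)))

    cut⇒BP2 : ∀ {y} → N H v y → y ∉ members → BP2 G
    cut⇒BP2 {y} Ny y∉C = coNbhdCover⇒BP2 v (proj₁ cut) coversCut
      where
      cut : Σ (Biclique G) λ bc → Covers bc (λ z → Inside z ⊎ Outside z)
      cut = fromSides (λ z → (z ∈? members) ×-dec adjacent? H v z)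
                      (λ z → ¬? (z ∈? members) ×-dec adjacent? H v z)
                      (λ { (z∈C , _) (z∉C , _) → z∉C z∈C })
                      (x , root , Nx) (y , y∉C , Ny) across
      coversCut : Covers (proj₁ cut) (N H v)
      coversCut z Nz = proj₂ cut z (sideOf (z ∈? members))
        where
        sideOf : Dec (z ∈ members) → Inside z ⊎ Outside z
        sideOf (yes z∈C) = inj₁ (z∈C , Nz)
        sideOf (no z∉C) = inj₂ (z∉C , Nz)

    connectedTo : ∀ y → N H v y → Star (InducedEdge H (N H v)) x y
    connectedTo y Ny with y ∈? members
    ... | yes y∈C = reachable y∈C
    ... | no y∉C = ⊥-elim (¬bp2 (cut⇒BP2 Ny y∉C))

  coNbhdConnected : ∀ v x y → N H v x → N H v y → Star (InducedEdge H (N H v)) x y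
  coNbhdConnected v x y Nx = CoNbhdComponent.connectedTo v x Nx y

  commonCoNeighbour : ∀ u w → ∃[ x ] (u ~[ H ] x × w ~[ H ] x)
  commonCoNeighbour u w with any? (λ x → adjacent? H u x ×-dec adjacent? H w x)
  ... | yes found = found
  ... | no none = ⊥-elim (¬bp2 (coNbhdCover⇒BP2 u (proj₁ (closedStar w)) inStar))
    where
    -- Without common neighbours, N_H(u) lies in the closed G-neighbourhood of w.
    inStar : Covers (proj₁ (closedStar w)) (N H u)
    inStar z Nz = proj₂ (closedStar w) z
      ([ id , (λ w~z → ⊥-elim (none (z , Nz , w~z))) ]′ (closedNbhd-or-coNbhd w z))

  distance≤2 : ∀ v u → Dist≤2 H v u
  distance≤2 v u with commonCoNeighbour v u
  ... | x , v~x , u~x = inj₂ (inj₂ (x , v~x , ~-sym H {u} {x} u~x))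

corollary1 : ∀ {n : ℕ} (G : Graph n) → ¬ BP2 G →
    (∀ (v : Fin n) → NeighbourhoodConnected≥2 (complement G) v)
    × (∀ (v u : Fin n) → u ≢ v → Dist≤2 (complement G) v u)
    × (∀ (u w : Fin n) → u ≢ w → ¬ (u ~[ complement G ] w) →
    ∃[ x ] (u ~[ complement G ] x × w ~[ complement G ] x))
corollary1 G ¬bp2 =
    (λ v → twoCoNeighbours v , coNbhdConnected v)
  , (λ v u _ → distance≤2 v u)
  , (λ u w _ _ → commonCoNeighbour u w)
  where open Density G ¬bp2
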